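{- Every $3$-edge-connected $3$-edge-colorable graph $G$ satisfies $f(G)\leq 3$.
   Context: Graphs are finite and undirected; parallel edges are allowed. For a graph $G=(V,E)$ and $X\subseteq V$, $\delta_G(X)$ is the set of edges with exactly one endvertex in $X$, and $G$ is $k$-edge-connected if $|\delta_G(X)|\ge k$ for every nonempty proper subset $X$ of $V$. $G$ is $3$-edge-colorable if $E$ can be partitioned into $3$ matchings. An orientation of $G$ replaces each edge $uv$ by exactly one of the arcs $uv$ or $vu$; for $e\in E$, $\vec e$ denotes the corresponding arc. A digraph is strongly connected if for every nonempty proper vertex subset $X$ some arc leaves $X$. For a $3$-edge-connected graph $G$, the Frank number $f(G)$ is the minimum integer $k$ such that there exist $k$ orientations $D_1,\dots,D_k$ of $G$ with the property that for every edge $e$ of $G$ there is an $i$ with $D_i-\vec e$ strongly connected. -}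

module Defs where

open import Data.Nat using (ℕ; _≤_)
open import Data.Fin using (Fin)
open import Data.Bool using (Bool; true; false)
open import Data.Product using (_×_; Σ; ∃; proj₁; proj₂; _,_)
open import Relation.Binary.PropositionalEquality using (_≡_; _≢_)
open import Data.List using (List; length; filter)
open import Data.List.Membership.Propositional using (_∈_)
open import Data.List.Relation.Unary.Unique.Propositional using (Unique)
open import Relation.Nullary using (¬_)

-- A finite undirected multigraph: vertices Fin n, edges Fin m,
-- each edge e has endpoints (proj₁ (ends e), proj₂ (ends e)).
-- Parallel edges are allowed (ends need not be injective).
record Graph : Set where
  field
    n    : ℕ
    m    : ℕ
    ends : Fin m → Fin n × Fin n

open Graph public

VSet : Graph → Set
VSet G = Fin (n G) → Bool

NonemptyProper : (G : Graph) → VSet G → Set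
NonemptyProper G X = (∃ λ v → X v ≡ true) × (∃ λ v → X v ≡ false)

InCut : (G : Graph) → VSet G → Fin (m G) → Set
InCut G X e = X (proj₁ (ends G e)) ≢ X (proj₂ (ends G e))

CutAtLeast : (G : Graph) → ℕ → VSet G → Set
CutAtLeast G k X =
  Σ (List (Fin (m G))) λ es →
    Unique es × (∀ e → e ∈ es → InCut G X e) × (k ≤ length es)

EdgeConnected : ℕ → Graph → Set
EdgeConnected k G = ∀ (X : VSet G) → NonemptyProper G X → CutAtLeast G k X

-- 3-edge-colourable: a colouring of edges with 3 colours such that any two
-- distinct edges of the same colour share no endvertex (each colour class is
-- a matching; in particular a loop cannot be in a matching).
SharesEnd : (G : Graph) → Fin (m G) → Fin (m G) → Set
SharesEnd G e f =
  (proj₁ (ends G e) ≡ proj₁ (ends G f)) ⊎' (proj₁ (ends G e) ≡ proj₂ (ends G f))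
  ⊎' (proj₂ (ends G e) ≡ proj₁ (ends G f)) ⊎' (proj₂ (ends G e) ≡ proj₂ (ends G f))
  where
  open import Data.Sum renaming (_⊎_ to _⊎'_)

IsMatching : (G : Graph) → (Fin (m G) → Set) → Set
IsMatching G M =
  (∀ e → M e → proj₁ (ends G e) ≢ proj₂ (ends G e)) ×
  (∀ e f → M e → M f → e ≢ f → ¬ SharesEnd G e f)

ThreeEdgeColorable : Graph → Set
ThreeEdgeColorable G =
  Σ (Fin (m G) → Fin 3) λ c → ∀ (i : Fin 3) → IsMatching G (λ e → c e ≡ i)

Orientation : Graph → Set
Orientation G = Fin (m G) → Bool

tail head : (G : Graph) → Orientation G → Fin (m G) → Fin (n G)
tail G o e with o e
... | true  = proj₁ (ends G e)
... | false = proj₂ (ends G e)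
head G o e with o e
... | true  = proj₂ (ends G e)
... | false = proj₁ (ends G e)

Leaves : (G : Graph) → Orientation G → VSet G → Fin (m G) → Set
Leaves G o X f = (X (tail G o f) ≡ true) × (X (head G o f) ≡ false)

-- D - e is strongly connected: every nonempty proper X has a leaving arc
-- other than the arc of e.
StronglyConnectedMinus : (G : Graph) → Orientation G → Fin (m G) → Set
StronglyConnectedMinus G o e =
  ∀ (X : VSet G) → NonemptyProper G X →
    ∃ λ f → (f ≢ e) × Leaves G o X f

-- f(G) ≤ k: there exist k orientations D_1..D_k such that every edge e has
-- some i with D_i - e strongly connected.
FrankNumberAtMost : ℕ → Graph → Set
FrankNumberAtMost k G =
  Σ (Fin k → Orientation G) λ D →
    ∀ (e : Fin (m G)) → ∃ λ (i : Fin k) → StronglyConnectedMinus G (D i) e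

-- A 3-edge-connected 3-edge-colourable graph is cubic, so each colour class
-- is a perfect matching and any two colour classes form disjoint even cycles,
-- which can be oriented as directed cycles. D i orients the edges of colour i
-- along the cycles of colours i and j, and all other edges along the cycles
-- of colours j and k. Let e have colour i and X be a nonempty proper vertex
-- set. If an edge of colour j or k crosses X, its directed cycle leaves X by
-- an arc, which is not e. Otherwise at least three edges of colour i cross X,
-- two of them distinct from e; each either leaves X or is followed along its
-- directed cycle by a first arc leaving X, and these first exits differ for
-- different entering arcs, so one of them is not e.
module Submission where

open import Defs
open import Data.Bool using (Bool; true; false; not; if_then_else_)
open import Data.Bool.Properties using (¬-not; not-¬; not-injective) renaming (_≟_ to _≟ᵇ_)
open import Data.Empty using (⊥; ⊥-elim)
open import Data.Fin as Fin using (Fin; zero; suc; toℕ; punchIn; punchOut)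
open import Data.Fin.Properties as Finₚ
  using (pigeonhole; punchOut-injective; punchIn-punchOut; punchInᵢ≢i; punchIn-injective; toℕ<n; any?)
  renaming (_≟_ to _≟ᶠ_)
open import Data.List using (List; []; _∷_; length)
open import Data.List.Membership.Propositional using (_∈_)
open import Data.List.Relation.Unary.All using (_∷_)
open import Data.List.Relation.Unary.AllPairs using (_∷_)
open import Data.List.Relation.Unary.Any using (here; there)
open import Data.List.Relation.Unary.Unique.Propositional using (Unique)
open import Data.Nat using (ℕ; zero; suc; _+_; _*_; _∸_; _≤_; _<_; s≤s; s≤s⁻¹)
open import Data.Nat.DivMod using (_%_; _/_; m≡m%n+[m/n]*n; m%n<n)
open import Data.Nat.GeneralisedArithmetic using (fold; fold-+)
open import Data.Nat.Properties
  using (+-comm; +-suc; *-suc; ≤-refl; ≤-total; ≤-trans; <-≤-trans; <⇒≤; m≤n+m; n<1+n; n≤1+n;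
         m+[n∸m]≡n; m≤n⇒m<n∨m≡n)
open import Data.Product using (∃; _×_; _,_; proj₁; proj₂)
open import Data.Sum using (_⊎_; inj₁; inj₂)
open import Function using (_∘_)
open import Function.Definitions using (Injective)
open import Relation.Binary.Definitions using (DecidableEquality; tri<; tri≈; tri>)
open import Relation.Binary.PropositionalEquality
open import Relation.Nullary using (¬_; Dec; yes; no; does; contradiction)
open import Relation.Nullary.Decidable using (dec-true; dec-false; ¬?; _×-dec_)

private
  variable
    A : Set

fold-suc-commute : ∀ (f : A → A) x k → fold (f x) f k ≡ f (fold x f k)
fold-suc-commute f x k = trans (sym (fold-+ x f k {1})) (cong (fold x f) (+-comm k 1))

fold-injective : ∀ {f : A → A} → Injective _≡_ _≡_ f →
  ∀ k {x y} → fold x f k ≡ fold y f k → x ≡ y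
fold-injective f-inj zero    eq = eq
fold-injective f-inj (suc k) eq = fold-injective f-inj k (f-inj eq)

fold-period-* : ∀ (f : A → A) x p → fold x f (suc p) ≡ x → ∀ q → fold x f (q * suc p) ≡ x
fold-period-* f x p period zero    = refl
fold-period-* f x p period (suc q) = begin
  fold x f (suc p + q * suc p)          ≡⟨ fold-+ x f (suc p) ⟩
  fold (fold x f (q * suc p)) f (suc p) ≡⟨ cong (λ y → fold y f (suc p)) (fold-period-* f x p period q) ⟩
  fold x f (suc p)                      ≡⟨ period ⟩
  x                                     ∎
  where open ≡-Reasoning

module Walk (f : A → A) (X : A → Bool) where

  StaysIn : A → ℕ → Set
  StaysIn x t = ∀ j → j ≤ t → X (fold x f j) ≡ true

  FirstExit : A → Set
  FirstExit x = ∃ λ t → StaysIn x t × X (fold x f (suc t)) ≡ false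

  stays-or-exits : ∀ {x} → X x ≡ true → ∀ k → StaysIn x k ⊎ FirstExit x
  stays-or-exits x∈X zero = inj₁ λ { zero _ → x∈X }
  stays-or-exits {x} x∈X (suc k) with stays-or-exits x∈X k
  ... | inj₂ exit = inj₂ exit
  ... | inj₁ stay with X (fold x f (suc k)) in eq
  ...   | false = inj₂ (k , stay , eq)
  ...   | true  = inj₁ stay′
    where
    stay′ : StaysIn x (suc k)
    stay′ j j≤1+k with m≤n⇒m<n∨m≡n j≤1+k
    ... | inj₁ j<1+k = stay j (s≤s⁻¹ j<1+k)
    ... | inj₂ refl  = eq

  first-exit : ∀ {x} k → X x ≡ true → X (fold x f k) ≡ false → FirstExit x
  first-exit k x∈X fᵏx∉X with stays-or-exits x∈X k
  ... | inj₁ stay = contradiction (trans (sym (stay k ≤-refl)) fᵏx∉X) λ ()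
  ... | inj₂ exit = exit

  -- Two walks that enter X from outside and stay in X cannot meet unless they
  -- entered from the same point: the later one would otherwise revisit the
  -- entry point of the earlier one, which lies outside X.
  entry-unique-≤ : Injective _≡_ _≡_ f → ∀ {u₁ u₂ t} d →
    X u₁ ≡ false → StaysIn (f u₂) (t + d) → fold (f u₁) f t ≡ fold (f u₂) f (t + d) → u₁ ≡ u₂
  entry-unique-≤ f-inj {u₁} {u₂} {t} d u₁∉X stay meet
    with fold-injective f-inj t (trans meet (fold-+ (f u₂) f t))
  ... | f-u₁≡ with d
  ...   | zero   = f-inj f-u₁≡
  ...   | suc d′ = contradiction (trans (sym (stay d′ (≤-trans (n≤1+n d′) (m≤n+m (suc d′) t))))
                                        (trans (cong X (sym (f-inj f-u₁≡))) u₁∉X)) λ ()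

  entry-unique : Injective _≡_ _≡_ f → ∀ {u₁ u₂ t₁ t₂} →
    X u₁ ≡ false → X u₂ ≡ false → StaysIn (f u₁) t₁ → StaysIn (f u₂) t₂ →
    fold (f u₁) f t₁ ≡ fold (f u₂) f t₂ → u₁ ≡ u₂
  entry-unique f-inj {t₁ = t₁} {t₂} u₁∉X u₂∉X stay₁ stay₂ meet with ≤-total t₁ t₂
  ... | inj₁ t₁≤t₂ = entry-unique-≤ f-inj (t₂ ∸ t₁) u₁∉X
    (subst (StaysIn _) (sym (m+[n∸m]≡n t₁≤t₂)) stay₂) (trans meet (cong (fold _ f) (sym (m+[n∸m]≡n t₁≤t₂))))
  ... | inj₂ t₂≤t₁ = sym (entry-unique-≤ f-inj (t₁ ∸ t₂) u₂∉X
    (subst (StaysIn _) (sym (m+[n∸m]≡n t₂≤t₁)) stay₁) (trans (sym meet) (cong (fold _ f) (sym (m+[n∸m]≡n t₂≤t₁)))))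

module Orbits {N : ℕ} (f : Fin N → Fin N) (f-injective : Injective _≡_ _≡_ f) where

  fold-periodic : ∀ x → ∃ λ p → suc p ≤ N × fold x f (suc p) ≡ x
  fold-periodic x with pigeonhole (n<1+n N) (λ i → fold x f (toℕ i))
  ... | i , j , i<j , fⁱx≡fʲx = d , bound , fold-injective f-injective (toℕ i) period
    where
    d = toℕ j ∸ suc (toℕ i)
    j≡ : toℕ i + suc d ≡ toℕ j
    j≡ = trans (+-suc (toℕ i) d) (m+[n∸m]≡n i<j)
    bound : suc d ≤ N
    bound = ≤-trans (subst (suc d ≤_) j≡ (m≤n+m (suc d) (toℕ i))) (s≤s⁻¹ (toℕ<n j))
    period : fold (fold x f (suc d)) f (toℕ i) ≡ fold x f (toℕ i)
    period = trans (sym (fold-+ x f (toℕ i))) (trans (cong (fold x f) j≡) (sym fⁱx≡fʲx))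

  infix 4 _↝_
  _↝_ : Fin N → Fin N → Set
  x ↝ y = ∃ λ k → fold x f k ≡ y

  ↝-step : ∀ x → x ↝ f x
  ↝-step x = 1 , refl

  ↝-trans : ∀ {x y z} → x ↝ y → y ↝ z → x ↝ z
  ↝-trans {x} (k , refl) (l , refl) = l + k , fold-+ x f l

  ↝-sym : ∀ {x y} → x ↝ y → y ↝ x
  ↝-sym {x} (k , refl) with fold-periodic x
  ... | p , _ , period = k * p , (begin
    fold (fold x f k) f (k * p) ≡⟨ sym (fold-+ x f (k * p)) ⟩
    fold x f (k * p + k)        ≡⟨ cong (fold x f) (trans (+-comm (k * p) k) (sym (*-suc k p))) ⟩
    fold x f (k * suc p)        ≡⟨ fold-period-* f x p period k ⟩
    x                           ∎)
    where open ≡-Reasoning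

  ↝-bounded : ∀ {x y} → x ↝ y → ∃ λ r → r < N × fold x f r ≡ y
  ↝-bounded {x} (k , refl) with fold-periodic x
  ... | p , p<N , period = k % suc p , <-≤-trans (m%n<n k (suc p)) p<N , sym (begin
    fold x f k                                    ≡⟨ cong (fold x f) (m≡m%n+[m/n]*n k (suc p)) ⟩
    fold x f (k % suc p + (k / suc p) * suc p)    ≡⟨ fold-+ x f (k % suc p) ⟩
    fold (fold x f ((k / suc p) * suc p)) f (k % suc p)
      ≡⟨ cong (λ y → fold y f (k % suc p)) (fold-period-* f x p period (k / suc p)) ⟩
    fold x f (k % suc p)                          ∎)
    where open ≡-Reasoning

  open import Algebra.Construct.NaturalChoice.Min (Finₚ.≤-totalOrder N) using (_⊓_; x⊓y≤x; x⊓y≤y; ⊓-sel)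

  minUpTo : ℕ → Fin N → Fin N
  minUpTo zero    x = x
  minUpTo (suc K) x = minUpTo K x ⊓ fold x f (suc K)

  minUpTo-≤ : ∀ K {x} t → t ≤ K → minUpTo K x Fin.≤ fold x f t
  minUpTo-≤ zero    zero    _     = Finₚ.≤-refl
  minUpTo-≤ (suc K) {x} t t≤1+K with m≤n⇒m<n∨m≡n t≤1+K
  ... | inj₁ t<1+K = Finₚ.≤-trans (x⊓y≤x (minUpTo K x) _) (minUpTo-≤ K t (s≤s⁻¹ t<1+K))
  ... | inj₂ refl  = x⊓y≤y (minUpTo K x) _

  minUpTo-reachable : ∀ K x → x ↝ minUpTo K x
  minUpTo-reachable zero    x = 0 , refl
  minUpTo-reachable (suc K) x with ⊓-sel (minUpTo K x) (fold x f (suc K))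
  ... | inj₁ eq = subst (x ↝_) (sym eq) (minUpTo-reachable K x)
  ... | inj₂ eq = suc K , sym eq

  orbitMin : Fin N → Fin N
  orbitMin = minUpTo N

  orbitMin-≤ : ∀ {x y} → x ↝ y → orbitMin x Fin.≤ y
  orbitMin-≤ x↝y with ↝-bounded x↝y
  ... | r , r<N , refl = minUpTo-≤ N r (<⇒≤ r<N)

  orbitMin-cong : ∀ {x y} → x ↝ y → orbitMin x ≡ orbitMin y
  orbitMin-cong {x} {y} x↝y = Finₚ.≤-antisym
    (orbitMin-≤ (↝-trans x↝y (minUpTo-reachable N y)))
    (orbitMin-≤ (↝-trans (↝-sym x↝y) (minUpTo-reachable N x)))

  orbitMin-≡⇒↝ : ∀ {x y} → orbitMin x ≡ orbitMin y → x ↝ y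
  orbitMin-≡⇒↝ {x} {y} eq =
    ↝-trans (minUpTo-reachable N x) (subst (_↝ y) (sym eq) (↝-sym (minUpTo-reachable N y)))

<?-flip : ∀ {N} {x y : Fin N} → x ≢ y → does (y Finₚ.<? x) ≡ not (does (x Finₚ.<? y))
<?-flip {x = x} {y} x≢y with Finₚ.<-cmp x y
... | tri< x<y _ _ = trans (dec-false (y Finₚ.<? x) (Finₚ.<-asym x<y)) (cong not (sym (dec-true (x Finₚ.<? y) x<y)))
... | tri≈ _ x≡y _ = contradiction x≡y x≢y
... | tri> _ _ y<x = trans (dec-true (y Finₚ.<? x) y<x) (cong not (sym (dec-false (x Finₚ.<? y) (Finₚ.<-asym y<x))))

even-or-odd : ∀ k → ∃ λ i → k ≡ i + i ⊎ k ≡ suc (i + i)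
even-or-odd zero = 0 , inj₁ refl
even-or-odd (suc k) with even-or-odd k
... | i , inj₁ refl = i , inj₂ refl
... | i , inj₂ refl = suc i , inj₁ (cong suc (sym (+-suc i i)))

Fin2-no-three-distinct : (x y z : Fin 2) → x ≢ y → x ≢ z → y ≢ z → ⊥
Fin2-no-three-distinct zero       zero       _          x≢y _   _   = x≢y refl
Fin2-no-three-distinct zero       (suc zero) zero       _   x≢z _   = x≢z refl
Fin2-no-three-distinct zero       (suc zero) (suc zero) _   _   y≢z = y≢z refl
Fin2-no-three-distinct (suc zero) zero       zero       _   _   y≢z = y≢z refl
Fin2-no-three-distinct (suc zero) zero       (suc zero) _   x≢z _   = x≢z refl
Fin2-no-three-distinct (suc zero) (suc zero) _          x≢y _   _   = x≢y refl

-- Punching out a value missed by x, y, z would give three distinct elements of Fin 2.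
Fin3-three-distinct-cover : ∀ {x y z : Fin 3} → x ≢ y → x ≢ z → y ≢ z →
  ∀ c → x ≡ c ⊎ y ≡ c ⊎ z ≡ c
Fin3-three-distinct-cover {x} {y} {z} x≢y x≢z y≢z c with x ≟ᶠ c | y ≟ᶠ c | z ≟ᶠ c
... | yes x≡c | _       | _       = inj₁ x≡c
... | no _    | yes y≡c | _       = inj₂ (inj₁ y≡c)
... | no _    | no _    | yes z≡c = inj₂ (inj₂ z≡c)
... | no x≢c  | no y≢c  | no z≢c  = ⊥-elim (Fin2-no-three-distinct
  (punchOut (x≢c ∘ sym)) (punchOut (y≢c ∘ sym)) (punchOut (z≢c ∘ sym))
  (x≢y ∘ punchOut-injective (x≢c ∘ sym) (y≢c ∘ sym)) (x≢z ∘ punchOut-injective (x≢c ∘ sym) (z≢c ∘ sym))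
  (y≢z ∘ punchOut-injective (y≢c ∘ sym) (z≢c ∘ sym)))

record Distinct₃ (P : A → Set) : Set where
  field
    x y z : A
    x≢y   : x ≢ y
    x≢z   : x ≢ z
    y≢z   : y ≢ z
    Px    : P x
    Py    : P y
    Pz    : P z

Unique⇒Distinct₃ : ∀ {P : A → Set} (xs : List A) → Unique xs → (∀ x → x ∈ xs → P x) →
  3 ≤ length xs → Distinct₃ P
Unique⇒Distinct₃ []           _ _ ()
Unique⇒Distinct₃ (_ ∷ [])     _ _ (s≤s ())
Unique⇒Distinct₃ (_ ∷ _ ∷ []) _ _ (s≤s (s≤s ()))
Unique⇒Distinct₃ (x ∷ y ∷ z ∷ _) ((x≢y ∷ x≢z ∷ _) ∷ (y≢z ∷ _) ∷ _) P-xs _ = record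
  { x≢y = x≢y ; x≢z = x≢z ; y≢z = y≢z
  ; Px = P-xs x (here refl) ; Py = P-xs y (there (here refl)) ; Pz = P-xs z (there (there (here refl))) }

Distinct₃-avoiding : ∀ {P : A → Set} → DecidableEquality A → Distinct₃ P → ∀ e →
  ∃ λ f₁ → ∃ λ f₂ → f₁ ≢ f₂ × f₁ ≢ e × f₂ ≢ e × P f₁ × P f₂
Distinct₃-avoiding _≟_ d e with Distinct₃.x d ≟ e | Distinct₃.y d ≟ e
... | yes refl | _        = y , z , y≢z , x≢y ∘ sym , x≢z ∘ sym , Py , Pz
  where open Distinct₃ d
... | no x≢e   | yes refl = x , z , x≢z , x≢e , y≢z ∘ sym , Px , Pz
  where open Distinct₃ d
... | no x≢e   | no y≢e   = x , y , x≢y , x≢e , y≢e , Px , Py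
  where open Distinct₃ d

module GraphFacts (G : Graph) where

  V E : Set
  V = Fin (n G)
  E = Fin (m G)

  fst snd : E → V
  fst e = proj₁ (ends G e)
  snd e = proj₂ (ends G e)

  Incident : V → E → Set
  Incident v e = fst e ≡ v ⊎ snd e ≡ v

  singleton : V → VSet G
  singleton v w = does (w ≟ᶠ v)

  singleton-nonemptyProper : ∀ {v w} → w ≢ v → NonemptyProper G (singleton v)
  singleton-nonemptyProper {v} {w} w≢v = (v , dec-true (v ≟ᶠ v) refl) , (w , dec-false (w ≟ᶠ v) w≢v)

  InCut-singleton : ∀ {v e} → InCut G (singleton v) e → Incident v e
  InCut-singleton {v} {e} cut with fst e ≟ᶠ v | snd e ≟ᶠ v
  ... | yes fst≡v | _         = inj₁ fst≡v
  ... | no _      | yes snd≡v = inj₂ snd≡v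
  ... | no _      | no _      = contradiction refl cut

  arc-true : ∀ (o : Orientation G) {e} → o e ≡ true → tail G o e ≡ fst e × head G o e ≡ snd e
  arc-true o {e} _ with o e
  arc-true o refl | true = refl , refl

  arc-false : ∀ (o : Orientation G) {e} → o e ≡ false → tail G o e ≡ snd e × head G o e ≡ fst e
  arc-false o {e} _ with o e
  arc-false o refl | false = refl , refl

  arc-ends : ∀ (o : Orientation G) e →
    (tail G o e ≡ fst e × head G o e ≡ snd e) ⊎ (tail G o e ≡ snd e × head G o e ≡ fst e)
  arc-ends o e = by-value (o e) refl
    where
    by-value : ∀ b → o e ≡ b →
      (tail G o e ≡ fst e × head G o e ≡ snd e) ⊎ (tail G o e ≡ snd e × head G o e ≡ fst e)
    by-value true  oe = inj₁ (arc-true o oe)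
    by-value false oe = inj₂ (arc-false o oe)

  arc-cong : ∀ {o o′ : Orientation G} {e} → o e ≡ o′ e →
    tail G o e ≡ tail G o′ e × head G o e ≡ head G o′ e
  arc-cong {o} {o′} {e} eq = by-value (o′ e) refl
    where
    by-value : ∀ b → o′ e ≡ b → tail G o e ≡ tail G o′ e × head G o e ≡ head G o′ e
    by-value true o′e = let t , h = arc-true o (trans eq o′e) ; t′ , h′ = arc-true o′ o′e in
      trans t (sym t′) , trans h (sym h′)
    by-value false o′e = let t , h = arc-false o (trans eq o′e) ; t′ , h′ = arc-false o′ o′e in
      trans t (sym t′) , trans h (sym h′)

  tail-incident : ∀ (o : Orientation G) e → Incident (tail G o e) e
  tail-incident o e with arc-ends o e
  ... | inj₁ (t , _) = inj₁ (sym t)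
  ... | inj₂ (t , _) = inj₂ (sym t)

  Enters : Orientation G → VSet G → E → Set
  Enters o X e = X (tail G o e) ≡ false × X (head G o e) ≡ true

  InCut⇒crossing : ∀ {X o e} → InCut G X e → X (tail G o e) ≢ X (head G o e)
  InCut⇒crossing {X} {o} {e} cut with arc-ends o e
  ... | inj₁ (t , h) = λ eq → cut (subst₂ (λ u w → X u ≡ X w) t h eq)
  ... | inj₂ (t , h) = λ eq → cut (subst₂ (λ u w → X u ≡ X w) h t (sym eq))

  crossing⇒InCut : ∀ {X o e} → X (tail G o e) ≢ X (head G o e) → InCut G X e
  crossing⇒InCut {X} {o} {e} crossing with arc-ends o e
  ... | inj₁ (t , h) = λ eq → crossing (subst₂ (λ u w → X u ≡ X w) (sym t) (sym h) eq)
  ... | inj₂ (t , h) = λ eq → crossing (subst₂ (λ u w → X u ≡ X w) (sym t) (sym h) (sym eq))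

  Leaves⇒InCut : ∀ (o : Orientation G) {X e} → Leaves G o X e → InCut G X e
  Leaves⇒InCut o {X} {e} (t∈X , h∉X) = crossing⇒InCut {X} {o} {e} λ eq → contradiction (trans (sym t∈X) (trans eq h∉X)) λ ()

  leaves-or-enters : ∀ (o : Orientation G) {X e} → InCut G X e → Leaves G o X e ⊎ Enters o X e
  leaves-or-enters o {X} {e} cut with X (tail G o e) | InCut⇒crossing {X} {o} cut
  ... | true  | crossing = inj₁ (refl , ¬-not λ eq → crossing (sym eq))
  ... | false | crossing = inj₂ (refl , ¬-not λ eq → crossing (sym eq))

  Leaves-cong : ∀ {X} {o o′ : Orientation G} {e} → o e ≡ o′ e → Leaves G o′ X e → Leaves G o X e
  Leaves-cong {X} {o} {o′} {e} eq (t∈X , h∉X) = let t , h = arc-cong {o} {o′} {e} eq in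
    trans (cong X t) t∈X , trans (cong X h) h∉X

  -- A spanning family of directed cycles of D: every vertex v has exactly one
  -- outgoing arc `out v` in the family, and its heads `succ` form a permutation.
  record CycleFactor (D : Orientation G) : Set₁ where
    field
      InFactor       : E → Set
      out            : V → E
      succ           : V → V
      out-in         : ∀ v → InFactor (out v)
      tail-out       : ∀ v → tail G D (out v) ≡ v
      head-out       : ∀ v → head G D (out v) ≡ succ v
      out-tail       : ∀ f → InFactor f → out (tail G D f) ≡ f
      succ-injective : Injective _≡_ _≡_ succ

  module FactorWalks {D : Orientation G} (factor : CycleFactor D) (X : VSet G) where
    open CycleFactor factor
    open Walk succ X
    open Orbits succ succ-injective using (↝-step; ↝-sym)

    succ-tail : ∀ {f} → InFactor f → succ (tail G D f) ≡ head G D f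
    succ-tail {f} f∈F = trans (sym (head-out _)) (cong (head G D) (out-tail f f∈F))

    exitArc : ∀ {v} → FirstExit v → E
    exitArc {v} (t , _) = out (fold v succ t)

    exitArc-leaves : ∀ {v} (exit : FirstExit v) → Leaves G D X (exitArc exit)
    exitArc-leaves (t , stay , exits) =
      trans (cong X (tail-out _)) (stay t ≤-refl) , trans (cong X (head-out _)) exits

    -- The cycle through an entering arc returns to its tail, which lies outside X.
    entering-exits : ∀ {f} → InFactor f → Enters D X f → FirstExit (succ (tail G D f))
    entering-exits {f} f∈F (t∉X , h∈X) with ↝-sym (↝-step (tail G D f))
    ... | k , returns = first-exit k (trans (cong X (succ-tail f∈F)) h∈X) (trans (cong X returns) t∉X)

    exitArc-injective : ∀ {f₁ f₂} → InFactor f₁ → InFactor f₂ → Enters D X f₁ → Enters D X f₂ →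
      (exit₁ : FirstExit (succ (tail G D f₁))) (exit₂ : FirstExit (succ (tail G D f₂))) →
      exitArc exit₁ ≡ exitArc exit₂ → f₁ ≡ f₂
    exitArc-injective {f₁} {f₂} f₁∈F f₂∈F (t₁∉X , _) (t₂∉X , _) (_ , stay₁ , _) (_ , stay₂ , _) same =
      begin
        f₁                ≡⟨ sym (out-tail f₁ f₁∈F) ⟩
        out (tail G D f₁) ≡⟨ cong out (entry-unique succ-injective t₁∉X t₂∉X stay₁ stay₂ meet) ⟩
        out (tail G D f₂) ≡⟨ out-tail f₂ f₂∈F ⟩
        f₂                ∎
      where
      open ≡-Reasoning
      meet = trans (sym (tail-out _)) (trans (cong (tail G D) same) (tail-out _))

    leaving-arc : ∀ {f} → InFactor f → InCut G X f → ∃ λ g → InFactor g × Leaves G D X g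
    leaving-arc {f} f∈F cut with leaves-or-enters D {X} {f} cut
    ... | inj₁ leaves = _ , f∈F , leaves
    ... | inj₂ enters = _ , out-in _ , exitArc-leaves (entering-exits f∈F enters)

    leaving-arc-avoiding : ∀ {f₁ f₂} e → InFactor f₁ → InFactor f₂ → f₁ ≢ f₂ → f₁ ≢ e → f₂ ≢ e →
      InCut G X f₁ → InCut G X f₂ → ∃ λ g → g ≢ e × Leaves G D X g
    leaving-arc-avoiding {f₁} {f₂} e f₁∈F f₂∈F f₁≢f₂ f₁≢e f₂≢e cut₁ cut₂
      with leaves-or-enters D {X} {f₁} cut₁ | leaves-or-enters D {X} {f₂} cut₂
    ... | inj₁ leaves₁ | _           = _ , f₁≢e , leaves₁
    ... | inj₂ _       | inj₁ leaves₂ = _ , f₂≢e , leaves₂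
    ... | inj₂ enters₁ | inj₂ enters₂
      with exitArc (entering-exits f₁∈F enters₁) ≟ᶠ e
    ...   | no g₁≢e  = _ , g₁≢e , exitArc-leaves (entering-exits f₁∈F enters₁)
    ...   | yes g₁≡e = _ , g₂≢e , exitArc-leaves exit₂
      where
      exit₂ = entering-exits f₂∈F enters₂
      g₂≢e : exitArc exit₂ ≢ e
      g₂≢e g₂≡e = f₁≢f₂ (exitArc-injective f₁∈F f₂∈F enters₁ enters₂
        (entering-exits f₁∈F enters₁) exit₂ (trans g₁≡e (sym g₂≡e)))

module ThreeEdgeColoured (G : Graph) (col : Fin (m G) → Fin 3)
  (matching : ∀ c → IsMatching G (λ e → col e ≡ c))
  (conn : EdgeConnected 3 G) (nontrivial : ∀ (v : Fin (n G)) → ∃ λ w → w ≢ v) where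

  open GraphFacts G

  loopless : ∀ e → fst e ≢ snd e
  loopless e = proj₁ (matching (col e)) e refl

  incident-colour-unique : ∀ {v e f} → col e ≡ col f → Incident v e → Incident v f → e ≡ f
  incident-colour-unique {v} {e} {f} same v∈e v∈f with e ≟ᶠ f
  ... | yes e≡f = e≡f
  ... | no e≢f  = ⊥-elim (proj₂ (matching (col e)) e f refl (sym same) e≢f (shared v∈e v∈f))
    where
    shared : Incident v e → Incident v f → SharesEnd G e f
    shared (inj₁ p) (inj₁ q) = inj₁ (trans p (sym q))
    shared (inj₁ p) (inj₂ q) = inj₂ (inj₁ (trans p (sym q)))
    shared (inj₂ p) (inj₁ q) = inj₂ (inj₂ (inj₁ (trans p (sym q))))
    shared (inj₂ p) (inj₂ q) = inj₂ (inj₂ (inj₂ (trans p (sym q))))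

  -- The three edges of the cut around v have distinct colours, so they use all three.
  opaque
    colour-at : ∀ v c → ∃ λ e → col e ≡ c × Incident v e
    colour-at v c = pick (Fin3-three-distinct-cover
      (colours-differ Px Py x≢y) (colours-differ Px Pz x≢z) (colours-differ Py Pz y≢z) c)
      where
      edges : Distinct₃ (Incident v)
      edges = let es , unique , cut , three = conn (singleton v) (singleton-nonemptyProper (proj₂ (nontrivial v)))
              in Unique⇒Distinct₃ es unique (λ e e∈es → InCut-singleton (cut e e∈es)) three
      open Distinct₃ edges
      colours-differ : ∀ {e f} → Incident v e → Incident v f → e ≢ f → col e ≢ col f
      colours-differ v∈e v∈f e≢f same = e≢f (incident-colour-unique same v∈e v∈f)
      pick : col x ≡ c ⊎ col y ≡ c ⊎ col z ≡ c → ∃ λ e → col e ≡ c × Incident v e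
      pick (inj₁ p)        = x , p , Px
      pick (inj₂ (inj₁ p)) = y , p , Py
      pick (inj₂ (inj₂ p)) = z , p , Pz

  edgeAt : Fin 3 → V → E
  edgeAt c v = proj₁ (colour-at v c)

  edgeAt-colour : ∀ c v → col (edgeAt c v) ≡ c
  edgeAt-colour c v = proj₁ (proj₂ (colour-at v c))

  edgeAt-incident : ∀ c v → Incident v (edgeAt c v)
  edgeAt-incident c v = proj₂ (proj₂ (colour-at v c))

  edgeAt-unique : ∀ {c v e} → col e ≡ c → Incident v e → edgeAt c v ≡ e
  edgeAt-unique {c} {v} ce v∈e =
    incident-colour-unique (trans (edgeAt-colour c v) (sym ce)) (edgeAt-incident c v) v∈e

  other : V → E → V
  other v e with fst e ≟ᶠ v
  ... | yes _ = snd e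
  ... | no _  = fst e

  other-spec : ∀ {v e} → Incident v e →
    (fst e ≡ v × other v e ≡ snd e) ⊎ (snd e ≡ v × other v e ≡ fst e)
  other-spec {v} {e} v∈e with fst e ≟ᶠ v
  ... | yes fst≡v = inj₁ (fst≡v , refl)
  ... | no fst≢v with v∈e
  ...   | inj₁ fst≡v = contradiction fst≡v fst≢v
  ...   | inj₂ snd≡v = inj₂ (snd≡v , refl)

  other-fst : ∀ e → other (fst e) e ≡ snd e
  other-fst e with fst e ≟ᶠ fst e
  ... | yes _    = refl
  ... | no fst≢fst = contradiction refl fst≢fst

  other-incident : ∀ {v e} → Incident v e → Incident (other v e) e
  other-incident v∈e with other-spec v∈e
  ... | inj₁ (_ , o) = inj₂ (sym o)
  ... | inj₂ (_ , o) = inj₁ (sym o)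

  other-≢ : ∀ {v e} → Incident v e → other v e ≢ v
  other-≢ {e = e} v∈e with other-spec v∈e
  ... | inj₁ (fst≡v , o) = λ o≡v → loopless e (trans fst≡v (sym (trans (sym o) o≡v)))
  ... | inj₂ (snd≡v , o) = λ o≡v → loopless e (trans (trans (sym o) o≡v) (sym snd≡v))

  other-involutive : ∀ {v e} → Incident v e → other (other v e) e ≡ v
  other-involutive {v} {e} v∈e with other-spec v∈e | other-spec (other-incident v∈e)
  ... | inj₁ (fst≡v , _) | inj₁ (fst≡o , _)  = contradiction (trans (sym fst≡o) fst≡v) (other-≢ v∈e)
  ... | inj₁ (fst≡v , _) | inj₂ (_ , o′)     = trans o′ fst≡v
  ... | inj₂ (snd≡v , _) | inj₁ (_ , o′)     = trans o′ snd≡v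
  ... | inj₂ (snd≡v , _) | inj₂ (snd≡o , _)  = contradiction (trans (sym snd≡o) snd≡v) (other-≢ v∈e)

  mate : Fin 3 → V → V
  mate c v = other v (edgeAt c v)

  mate-edge : ∀ {c v e} → col e ≡ c → Incident v e → mate c v ≡ other v e
  mate-edge ce v∈e = cong (other _) (edgeAt-unique ce v∈e)

  mate-≢ : ∀ c v → mate c v ≢ v
  mate-≢ c v = other-≢ (edgeAt-incident c v)

  mate-involutive : ∀ c v → mate c (mate c v) ≡ v
  mate-involutive c v = begin
    other (mate c v) (edgeAt c (mate c v)) ≡⟨ mate-edge (edgeAt-colour c v) (other-incident (edgeAt-incident c v)) ⟩
    other (mate c v) (edgeAt c v)          ≡⟨ other-involutive (edgeAt-incident c v) ⟩
    v                                      ∎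
    where open ≡-Reasoning

  mate-injective : ∀ c → Injective _≡_ _≡_ (mate c)
  mate-injective c {x} {y} eq =
    trans (sym (mate-involutive c x)) (trans (cong (mate c) eq) (mate-involutive c y))

  -- Colours a and b span disjoint even alternating cycles. σ = mate b ∘ mate a
  -- splits each of them into two orbits, which mate a swaps; `side v` records
  -- whether the orbit of v has the smaller minimum. Every a- or b-edge is then
  -- directed away from the endpoint whose side selects its colour.
  module TwoColours (a b : Fin 3) (a≢b : a ≢ b) where

    σ : V → V
    σ v = mate b (mate a v)

    σ-injective : Injective _≡_ _≡_ σ
    σ-injective eq = mate-injective a (mate-injective b eq)

    open Orbits σ σ-injective using (_↝_; orbitMin; orbitMin-cong; orbitMin-≡⇒↝)

    σ-mate-σ : ∀ v → σ (mate a (σ v)) ≡ mate a v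
    σ-mate-σ v = trans (cong (mate b) (mate-involutive a (σ v))) (mate-involutive b (mate a v))

    fold-σ-mate : ∀ i v → fold (mate a (fold v σ i)) σ i ≡ mate a v
    fold-σ-mate zero    v = refl
    fold-σ-mate (suc i) v = begin
      fold (mate a (σ w)) σ (suc i) ≡⟨ sym (fold-suc-commute σ _ i) ⟩
      fold (σ (mate a (σ w))) σ i   ≡⟨ cong (λ u → fold u σ i) (σ-mate-σ w) ⟩
      fold (mate a w) σ i           ≡⟨ fold-σ-mate i v ⟩
      mate a v                      ∎
      where
      w = fold v σ i
      open ≡-Reasoning

    -- If σᵏ v were mate a v, the middle of that path would be fixed by mate a
    -- (k even) or by mate b (k odd).
    mate-unreachable : ∀ v → ¬ (v ↝ mate a v)
    mate-unreachable v (k , σᵏv≡) with even-or-odd k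
    ... | i , inj₁ refl = mate-≢ a w (sym (fold-injective σ-injective i (begin
      fold w σ i          ≡⟨ sym (fold-+ v σ i) ⟩
      fold v σ (i + i)    ≡⟨ σᵏv≡ ⟩
      mate a v            ≡⟨ sym (fold-σ-mate i v) ⟩
      fold (mate a w) σ i ∎)))
      where
      w = fold v σ i
      open ≡-Reasoning
    ... | i , inj₂ refl = mate-≢ b (mate a w) (fold-injective σ-injective i (begin
      fold (σ w) σ i         ≡⟨ fold-suc-commute σ w i ⟩
      σ (fold w σ i)         ≡⟨ cong σ (sym (fold-+ v σ i)) ⟩
      fold v σ (suc (i + i)) ≡⟨ σᵏv≡ ⟩
      mate a v               ≡⟨ sym (fold-σ-mate i v) ⟩
      fold (mate a w) σ i    ∎))
      where
      w = fold v σ i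
      open ≡-Reasoning

    opaque
      side : V → Bool
      side v = does (orbitMin v Finₚ.<? orbitMin (mate a v))

      side-swap : ∀ {v w} → orbitMin w ≡ orbitMin (mate a v) → orbitMin (mate a w) ≡ orbitMin v →
        side w ≡ not (side v)
      side-swap {v} eq₁ eq₂ = trans (cong₂ (λ p q → does (p Finₚ.<? q)) eq₁ eq₂)
                                    (<?-flip (mate-unreachable v ∘ orbitMin-≡⇒↝))

    colour : Bool → Fin 3
    colour β = if β then a else b

    colour-injective : ∀ {β γ} → colour β ≡ colour γ → β ≡ γ
    colour-injective {true}  {true}  _  = refl
    colour-injective {true}  {false} eq = contradiction eq a≢b
    colour-injective {false} {true}  eq = contradiction (sym eq) a≢b
    colour-injective {false} {false} _  = refl

    side-mate : ∀ β v → side (mate (colour β) v) ≡ not (side v)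
    side-mate true  v = side-swap refl (cong orbitMin (mate-involutive a v))
    side-mate false v = side-swap (sym (orbitMin-cong (1 , cong (mate b) (mate-involutive a v))))
                                  (orbitMin-cong (1 , trans (cong (mate b) (mate-involutive a _)) (mate-involutive b v)))

    side-snd : ∀ {β e} → col e ≡ colour β → side (snd e) ≡ not (side (fst e))
    side-snd {β} {e} ce = begin
      side (snd e)                      ≡⟨ cong side (sym (trans (mate-edge ce (inj₁ refl)) (other-fst e))) ⟩
      side (mate (colour β) (fst e))    ≡⟨ side-mate β (fst e) ⟩
      not (side (fst e))                ∎
      where open ≡-Reasoning

    orientation : Orientation G
    orientation e = does (colour (side (fst e)) ≟ᶠ col e)

    orientation-ends : ∀ {β v e} → col e ≡ colour β → Incident v e → side v ≡ β →
      tail G orientation e ≡ v × head G orientation e ≡ mate (colour β) v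
    orientation-ends {β} {v} {e} ce v∈e sv with other-spec v∈e
    ... | inj₁ (fst≡v , o) =
      let t , h = arc-true orientation (dec-true (_ ≟ᶠ _) (trans (cong colour (trans (cong side fst≡v) sv)) (sym ce)))
      in trans t fst≡v , trans h (sym (trans (mate-edge ce v∈e) o))
    ... | inj₂ (snd≡v , o) =
      let t , h = arc-false orientation (dec-false (_ ≟ᶠ _) fst-not-source)
      in trans t snd≡v , trans h (sym (trans (mate-edge ce v∈e) o))
      where
      fst-not-source : colour (side (fst e)) ≢ col e
      fst-not-source eq = not-¬ refl (trans (sym (trans (cong side snd≡v) sv))
        (trans (side-snd ce) (cong not (colour-injective (trans eq ce)))))

    side-tail : ∀ {β f} → col f ≡ colour β → side (tail G orientation f) ≡ β
    side-tail {β} {f} cf = by-source (colour (side (fst f)) ≟ᶠ col f)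
      where
      by-source : Dec (colour (side (fst f)) ≡ col f) → side (tail G orientation f) ≡ β
      by-source (yes eq) = trans (cong side (proj₁ (arc-true orientation (dec-true (_ ≟ᶠ _) eq))))
                                 (colour-injective (trans eq cf))
      by-source (no neq) = trans (cong side (proj₁ (arc-false orientation (dec-false (_ ≟ᶠ _) neq))))
        (trans (side-snd cf) (sym (¬-not λ β≡ → neq (trans (cong colour (sym β≡)) (sym cf)))))

    out : V → E
    out v = edgeAt (colour (side v)) v

    succ : V → V
    succ v = mate (colour (side v)) v

    succ-injective : Injective _≡_ _≡_ succ
    succ-injective {x} {y} eq =
      mate-injective (colour (side x)) (trans eq (cong (λ β → mate (colour β) y) (sym same-side)))
      where
      same-side : side x ≡ side y
      same-side = not-injective (trans (sym (side-mate (side x) x)) (trans (cong side eq) (side-mate (side y) y)))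

    InFactor : E → Set
    InFactor e = ∃ λ β → col e ≡ colour β

    factor : CycleFactor orientation
    factor = record
      { InFactor       = InFactor
      ; out            = out
      ; succ           = succ
      ; out-in         = λ v → side v , edgeAt-colour _ v
      ; tail-out       = λ v → proj₁ (out-ends v)
      ; head-out       = λ v → proj₂ (out-ends v)
      ; out-tail       = λ { f (β , cf) →
          edgeAt-unique (trans cf (cong colour (sym (side-tail cf)))) (tail-incident orientation f) }
      ; succ-injective = succ-injective
      }
      where
      out-ends : ∀ v → tail G orientation (out v) ≡ v × head G orientation (out v) ≡ succ v
      out-ends v = orientation-ends (edgeAt-colour _ v) (edgeAt-incident _ v) refl

  module OwnCycles (i : Fin 3) = TwoColours i (punchIn i zero) (punchInᵢ≢i i zero ∘ sym)
  module OtherCycles (i : Fin 3) =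
    TwoColours (punchIn i zero) (punchIn i (suc zero)) (λ eq → contradiction (punchIn-injective i _ _ eq) λ ())

  D : Fin 3 → Orientation G
  D i e = if does (col e ≟ᶠ i) then OwnCycles.orientation i e else OtherCycles.orientation i e

  D-own : ∀ {i e} → col e ≡ i → D i e ≡ OwnCycles.orientation i e
  D-own {i} {e} ce = cong (if_then OwnCycles.orientation i e else OtherCycles.orientation i e) (dec-true (col e ≟ᶠ i) ce)

  D-other : ∀ {i e} → col e ≢ i → D i e ≡ OtherCycles.orientation i e
  D-other {i} {e} ce = cong (if_then OwnCycles.orientation i e else OtherCycles.orientation i e) (dec-false (col e ≟ᶠ i) ce)

  OtherCycles-InFactor : ∀ {i f} → col f ≢ i → OtherCycles.InFactor i f
  OtherCycles-InFactor {i} {f} f≢i = by-index (punchOut (f≢i ∘ sym)) (sym (punchIn-punchOut (f≢i ∘ sym)))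
    where
    by-index : ∀ k → col f ≡ punchIn i k → OtherCycles.InFactor i f
    by-index zero       cf = true , cf
    by-index (suc zero) cf = false , cf

  OtherCycles-InFactor⇒≢ : ∀ {i f} → OtherCycles.InFactor i f → col f ≢ i
  OtherCycles-InFactor⇒≢ {i} (true  , cf) fi = punchInᵢ≢i i zero (trans (sym cf) fi)
  OtherCycles-InFactor⇒≢ {i} (false , cf) fi = punchInᵢ≢i i (suc zero) (trans (sym cf) fi)

  leaving-other-colour : ∀ {i e f} X → col e ≡ i → col f ≢ i → InCut G X f →
    ∃ λ g → g ≢ e × Leaves G (D i) X g
  leaving-other-colour {i} X ce f≢i cut =
    let g , g∈F , leaves = FactorWalks.leaving-arc (OtherCycles.factor i) X (OtherCycles-InFactor f≢i) cut
    in g , (λ g≡e → OtherCycles-InFactor⇒≢ g∈F (trans (cong col g≡e) ce))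
         , Leaves-cong {X} {D i} {OtherCycles.orientation i} {g} (D-other (OtherCycles-InFactor⇒≢ g∈F)) leaves

  leaving-own-colour : ∀ {i} X e → (∀ f → InCut G X f → col f ≡ i) → Distinct₃ (InCut G X) →
    ∃ λ g → g ≢ e × Leaves G (D i) X g
  leaving-own-colour {i} X e cut-own cut-edges =
    let f₁ , f₂ , f₁≢f₂ , f₁≢e , f₂≢e , cut₁ , cut₂ = Distinct₃-avoiding _≟ᶠ_ cut-edges e
        g , g≢e , leaves = FactorWalks.leaving-arc-avoiding (OwnCycles.factor i) X e
          (true , cut-own _ cut₁) (true , cut-own _ cut₂) f₁≢f₂ f₁≢e f₂≢e cut₁ cut₂
    in g , g≢e , Leaves-cong {X} {D i} {OwnCycles.orientation i} {g}
                   (D-own (cut-own g (Leaves⇒InCut (OwnCycles.orientation i) {X} {g} leaves))) leaves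

  D-minus-strongly-connected : ∀ e → StronglyConnectedMinus G (D (col e)) e
  D-minus-strongly-connected e X nonempty-proper
    with any? (λ f → ¬? (col f ≟ᶠ col e) ×-dec ¬? (X (fst f) ≟ᵇ X (snd f)))
  ... | yes (f , f≢e , cut) = leaving-other-colour X refl f≢e cut
  ... | no no-other =
    let es , unique , cut , three = conn X nonempty-proper
    in leaving-own-colour X e cut-own (Unique⇒Distinct₃ es unique cut three)
    where
    cut-own : ∀ f → InCut G X f → col f ≡ col e
    cut-own f cut with col f ≟ᶠ col e
    ... | yes same = same
    ... | no differ = contradiction (f , differ , cut) no-other

  frank-number-≤-3 : FrankNumberAtMost 3 G
  frank-number-≤-3 = D , λ e → col e , D-minus-strongly-connected e

FrankNumberAtMost-subsingleton : ∀ {k} G → (∀ (v w : Fin (n G)) → v ≡ w) → FrankNumberAtMost (suc k) G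
FrankNumberAtMost-subsingleton G all-equal = (λ _ _ → true) , λ _ → zero , λ X ((v , v∈X) , (w , w∉X)) →
  contradiction (trans (sym v∈X) (trans (cong X (all-equal v w)) w∉X)) λ ()

Fin-subsingleton-or-nontrivial : ∀ k → (∀ (v w : Fin k) → v ≡ w) ⊎ (∀ (v : Fin k) → ∃ λ w → w ≢ v)
Fin-subsingleton-or-nontrivial zero          = inj₁ λ ()
Fin-subsingleton-or-nontrivial (suc zero)    = inj₁ λ { zero zero → refl }
Fin-subsingleton-or-nontrivial (suc (suc k)) = inj₂ λ { zero → suc zero , λ () ; (suc _) → zero , λ () }

theorem4 : (G : Graph) → EdgeConnected 3 G → ThreeEdgeColorable G →
    FrankNumberAtMost 3 G
theorem4 G conn (col , matching) with Fin-subsingleton-or-nontrivial (n G)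
... | inj₁ subsingleton = FrankNumberAtMost-subsingleton G subsingleton
... | inj₂ nontrivial   = ThreeEdgeColoured.frank-number-≤-3 G col matching conn nontrivial
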